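{- For every P-complete decision problem $L\subseteq\{0,1\}^*$, the flattened problem of $L$ can be computed by monotone circuits of at most polynomial size: there exist a polynomial $p$ and monotone Boolean circuits $C_n$ ($n\ge 0$) with $2n$ inputs and size at most $p(n)$ such that for all $w\in\{0,1\}^n$, $C_n(\mathrm{flat}(w))=1$ if and only if $w\in L$.
   Context: A monotone Boolean circuit is a Boolean circuit built only from AND and OR gates, with no NOT gates; its size is its number of gates. For $w=w_1\cdots w_n\in\{0,1\}^n$, $\mathrm{flat}(w)=\varphi(w_1)\cdots\varphi(w_n)$ with $\varphi(0)=10$, $\varphi(1)=01$. The flattened problem of $L$ is the language $\{\mathrm{flat}(w): w\in L\}$. P-completeness is with respect to deterministic logarithmic-space many-one reductions. -}

module Defs where

open import Data.Bool using (Bool; true; false; not; _∧_; _∨_; if_then_else_)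
open import Data.Nat using (ℕ; zero; suc; _+_; _*_; _^_; _≤_; _≤ᵇ_; _≡ᵇ_; pred; _⊔_)
open import Data.Nat.Logarithm using (⌊log₂_⌋)
open import Data.Fin as Fin using (Fin)
open import Data.List using (List; []; _∷_; _++_; [_]; length)
open import Data.Vec using (Vec; []; _∷_)
open import Data.Maybe using (Maybe; just; nothing)
open import Data.Product using (Σ; ∃; _×_; _,_)
open import Function.Bundles using (_⇔_)
open import Relation.Binary.PropositionalEquality using (_≡_)

Language : Set₁
Language = List Bool → Set

-- Deterministic Turing machines with a read-only input tape (with end
-- markers), one read/write work tape, and a write-only (append-only)
-- output tape.  Work alphabet: Fin (suc Γ), with Fin.zero the blank.

data InSym : Set where
  lend rend : InSym
  bit       : Bool → InSym

data Move : Set where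
  L S R : Move

data Action (Q Γ : ℕ) : Set where
  halt : Bool → Action Q Γ                    -- halt, accept (true) / reject (false)
  go   : Fin Q → Fin (suc Γ) → Move → Move → Maybe Bool → Action Q Γ
  --     new state, symbol written on work tape, input-head move,
  --     work-head move, optional bit appended to the output tape

record Machine : Set where
  field
    Q     : ℕ
    Γ     : ℕ
    start : Fin Q
    δ     : Fin Q → InSym → Fin (suc Γ) → Action Q Γ

record Config (M : Machine) : Set where
  constructor cfg
  open Machine M
  field
    state  : Fin Q
    inPos  : ℕ                 -- 0 = left marker, 1..n = input, n+1 = right marker
    tape   : ℕ → Fin (suc Γ)
    wPos   : ℕ
    maxPos : ℕ
    out    : List Bool

readIn : List Bool → ℕ → InSym
readIn w zero = lend
readIn [] (suc i) = rend
readIn (b ∷ w) (suc zero) = bit b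
readIn (b ∷ w) (suc (suc i)) = readIn w (suc i)

moveIn : ℕ → Move → ℕ → ℕ
moveIn n L i = pred i
moveIn n S i = i
moveIn n R i = if i ≤ᵇ n then suc i else i

moveW : Move → ℕ → ℕ
moveW L i = pred i
moveW S i = i
moveW R i = suc i

appendOut : Maybe Bool → List Bool → List Bool
appendOut nothing  o = o
appendOut (just b) o = o ++ [ b ]

data Status (M : Machine) : Set where
  done    : Bool → Config M → Status M
  running : Config M → Status M

step : (M : Machine) → List Bool → Config M → Status M
step M w c with Machine.δ M (Config.state c) (readIn w (Config.inPos c)) (Config.tape c (Config.wPos c))
... | halt b = done b c
... | go q a mi mw o =
  running (cfg q
               (moveIn (length w) mi (Config.inPos c))
               (λ j → if j ≡ᵇ Config.wPos c then a else Config.tape c j)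
               (moveW mw (Config.wPos c))
               (Config.maxPos c ⊔ moveW mw (Config.wPos c))
               (appendOut o (Config.out c)))

initial : (M : Machine) → Config M
initial M = cfg (Machine.start M) 1 (λ _ → Fin.zero) 0 0 []

exec : (M : Machine) → List Bool → ℕ → Config M → Status M
exec M w zero c = running c
exec M w (suc t) c with step M w c
... | done b c'  = done b c'
... | running c' = exec M w t c'

HaltsWithin : (M : Machine) → List Bool → ℕ → Bool → Config M → Set
HaltsWithin M w t b c = exec M w t (initial M) ≡ done b c

-- The class P: decided by a machine in polynomial time
-- (polynomial bounds are written c * n ^ k + c, which dominate every polynomial)

InP : Language → Set
InP P = Σ Machine λ M → Σ ℕ λ c → Σ ℕ λ k → ∀ (w : List Bool) →
  Σ Bool λ b → Σ (Config M) λ cf →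
    HaltsWithin M w (c * length w ^ k + c) b cf × (b ≡ true ⇔ P w)

_≤log_ : Language → Language → Set
L₁ ≤log L₂ = Σ Machine λ M → Σ ℕ λ c → ∀ (w : List Bool) →
  Σ ℕ λ t → Σ Bool λ b → Σ (Config M) λ cf →
    HaltsWithin M w t b cf ×
    Config.maxPos cf ≤ c * ⌊log₂ length w ⌋ + c ×
    (L₁ w ⇔ L₂ (Config.out cf))

PComplete : Language → Set₁
PComplete P = InP P × (∀ (P′ : Language) → InP P′ → P′ ≤log P)

-- Monotone Boolean circuits (fan-in 2 AND/OR gates, constants allowed),
-- as straight-line programs; size = number of gates.

data Wire (m g : ℕ) : Set where
  input : Fin m → Wire m g
  gate  : Fin g → Wire m g
  const : Bool → Wire m g

data Gate (m g : ℕ) : Set where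
  AND OR : Wire m g → Wire m g → Gate m g

data Gates (m : ℕ) : ℕ → Set where
  []  : Gates m 0
  _▷_ : ∀ {g} → Gates m g → Gate m g → Gates m (suc g)

record MonCircuit (m : ℕ) : Set where
  field
    size   : ℕ
    gates  : Gates m size
    output : Wire m size

open MonCircuit public

evalWire : ∀ {m g} → (Fin m → Bool) → (Fin g → Bool) → Wire m g → Bool
evalWire x v (input i) = x i
evalWire x v (gate j)  = v j
evalWire x v (const b) = b

evalGate : ∀ {m g} → (Fin m → Bool) → (Fin g → Bool) → Gate m g → Bool
evalGate x v (AND a b) = evalWire x v a ∧ evalWire x v b
evalGate x v (OR a b)  = evalWire x v a ∨ evalWire x v b

-- values of all gates; de Bruijn convention: in  gs ▷ γ  index zero is the
-- newest gate γ and  suc j  is gate j of gs (so wires only refer to earlier gates)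
evalGates : ∀ {m g} → (Fin m → Bool) → Gates m g → Fin g → Bool
evalGates x (gs ▷ γ) Fin.zero    = evalGate x (evalGates x gs) γ
evalGates x (gs ▷ γ) (Fin.suc j) = evalGates x gs j

eval : ∀ {m} → MonCircuit m → (Fin m → Bool) → Bool
eval C x = evalWire x (evalGates x (gates C)) (output C)

flat : ∀ {n} → Vec Bool n → Vec Bool (n * 2)
flat []      = []
flat (b ∷ w) = not b ∷ b ∷ flat w

module Submission where

-- The flattening replaces each input bit b by the pair (¬b, b): it supplies
-- every literal together with its negation.  Negations can therefore be kept
-- at the inputs.  A formula in negation normal form (NNF) is a monotone
-- function of the literals, and a dual-rail circuit, which carries for every
-- Boolean quantity one wire for its value and one for its negation (the
-- latter computed from the De Morgan dual formula), needs no NOT gates.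

open import Defs
open import Data.Bool using (Bool; true; false; not; _∧_; _∨_; if_then_else_)
open import Data.Bool.Properties using (not-involutive; ∨-identityʳ; ∨-zeroʳ; T-≡)
open import Data.Bool.ListAction using (any)
open import Data.Nat using (ℕ; zero; suc; _+_; _*_; _^_; _≤_; _<_; z≤n; s≤s; _≡ᵇ_; _≤ᵇ_; _⊔_)
open import Data.Nat.Properties using (≡ᵇ⇒≡; ≡⇒≡ᵇ; ≤ᵇ⇒≤; module ≤-Reasoning;
  ≤-refl; ≤-reflexive; ≤-trans; ≤-<-trans; n≤1+n; m≤n⇒m≤1+n; pred[n]≤n; m≤m+n; m≤n+m;
  +-identityʳ; +-assoc; +-comm; +-suc; +-mono-≤; +-monoˡ-≤; +-monoʳ-≤;
  *-identityˡ; *-identityʳ; *-assoc; *-distribˡ-+; *-distribʳ-+; [m*n]*[o*p]≡[m*o]*[n*p];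
  *-mono-≤; *-monoʳ-≤; ^-distribˡ-+-*; ^-zeroˡ; ^-monoˡ-≤; ^-monoʳ-≤; m^n>0)
open import Data.Fin as Fin using (Fin; toℕ; fromℕ<)
open import Data.Fin.Properties using (toℕ-injective; toℕ-fromℕ<; fromℕ<-toℕ; toℕ<n)
open import Data.List using (List; []; _∷_; _++_; length; map; allFin; cartesianProductWith)
open import Data.List.Properties using (length-tabulate; length-++; length-map)
open import Data.List.Membership.Propositional using (_∈_)
open import Data.List.Membership.Propositional.Properties using (∈-allFin; ∈-++⁺ˡ; ∈-++⁺ʳ; ∈-map⁺;
  ∈-cartesianProductWith⁺)
open import Data.List.Relation.Unary.Any using (here; there)
open import Data.Vec using (Vec; lookup; toList; []; _∷_)
open import Data.Vec.Properties using (length-toList)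
open import Data.Product using (Σ; _×_; _,_; proj₁; proj₂)
open import Data.Unit using (⊤; tt)
open import Function using (_∘_)
open import Function.Bundles using (_⇔_; mk⇔; Equivalence)
open import Relation.Binary.PropositionalEquality

data NNF (X : Set) : Set where
  var nvar : X → NNF X
  cst      : Bool → NNF X
  and or   : NNF X → NNF X → NNF X

module _ {X : Set} where

  evalNNF : (X → Bool) → NNF X → Bool
  evalNNF v (var x)   = v x
  evalNNF v (nvar x)  = not (v x)
  evalNNF v (cst b)   = b
  evalNNF v (and a b) = evalNNF v a ∧ evalNNF v b
  evalNNF v (or a b)  = evalNNF v a ∨ evalNNF v b

  evalNNF-cong : ∀ {v v′ : X → Bool} → v ≗ v′ → ∀ f → evalNNF v f ≡ evalNNF v′ f
  evalNNF-cong v≗v′ (var x)   = v≗v′ x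
  evalNNF-cong v≗v′ (nvar x)  = cong not (v≗v′ x)
  evalNNF-cong v≗v′ (cst b)   = refl
  evalNNF-cong v≗v′ (and a b) = cong₂ _∧_ (evalNNF-cong v≗v′ a) (evalNNF-cong v≗v′ b)
  evalNNF-cong v≗v′ (or a b)  = cong₂ _∨_ (evalNNF-cong v≗v′ a) (evalNNF-cong v≗v′ b)

  -- the number of binary connectives, i.e. of gates needed to compute f
  nnfSize : NNF X → ℕ
  nnfSize (var x)   = 0
  nnfSize (nvar x)  = 0
  nnfSize (cst b)   = 0
  nnfSize (and a b) = nnfSize a + nnfSize b + 1
  nnfSize (or a b)  = nnfSize a + nnfSize b + 1

  dual : NNF X → NNF X
  dual (var x)   = nvar x
  dual (nvar x)  = var x
  dual (cst b)   = cst (not b)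
  dual (and a b) = or (dual a) (dual b)
  dual (or a b)  = and (dual a) (dual b)

  evalNNF-dual : ∀ v f → evalNNF v (dual f) ≡ not (evalNNF v f)
  evalNNF-dual v (var x)   = refl
  evalNNF-dual v (nvar x)  = sym (not-involutive (v x))
  evalNNF-dual v (cst b)   = refl
  evalNNF-dual v (and a b) =
    trans (cong₂ _∨_ (evalNNF-dual v a) (evalNNF-dual v b)) (deMorgan∧ (evalNNF v a) _)
    where
    deMorgan∧ : ∀ p q → not p ∨ not q ≡ not (p ∧ q)
    deMorgan∧ true  q = refl
    deMorgan∧ false q = refl
  evalNNF-dual v (or a b)  =
    trans (cong₂ _∧_ (evalNNF-dual v a) (evalNNF-dual v b)) (deMorgan∨ (evalNNF v a) _)
    where
    deMorgan∨ : ∀ p q → not p ∧ not q ≡ not (p ∨ q)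
    deMorgan∨ true  q = refl
    deMorgan∨ false q = refl

  nnfSize-dual : ∀ f → nnfSize (dual f) ≡ nnfSize f
  nnfSize-dual (var x)   = refl
  nnfSize-dual (nvar x)  = refl
  nnfSize-dual (cst b)   = refl
  nnfSize-dual (and a b) = cong₂ (λ p q → p + q + 1) (nnfSize-dual a) (nnfSize-dual b)
  nnfSize-dual (or a b)  = cong₂ (λ p q → p + q + 1) (nnfSize-dual a) (nnfSize-dual b)

  ⋁ : ∀ {A : Set} → List A → (A → NNF X) → NNF X
  ⋁ []       f = cst false
  ⋁ (a ∷ as) f = or (f a) (⋁ as f)

  evalNNF-⋁ : ∀ {A : Set} v (as : List A) (f : A → NNF X) →
              evalNNF v (⋁ as f) ≡ any (λ a → evalNNF v (f a)) as
  evalNNF-⋁ v []       f = refl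
  evalNNF-⋁ v (a ∷ as) f = cong (evalNNF v (f a) ∨_) (evalNNF-⋁ v as f)

cost : ∀ {X U : Set} → (U → NNF X) → List U → ℕ
cost f []       = 0
cost f (u ∷ us) = nnfSize (f u) + cost f us

cost-≤ : ∀ {X U : Set} (f : U → NNF X) (us : List U) {B} →
         (∀ u → nnfSize (f u) ≤ B) → cost f us ≤ length us * B
cost-≤ f []       f≤B = z≤n
cost-≤ f (u ∷ us) f≤B = +-mono-≤ (f≤B u) (cost-≤ f us f≤B)

⟦_⟧ : ∀ {m g} → Gates m g → (Fin m → Bool) → Wire m g → Bool
⟦ gs ⟧ x = evalWire x (evalGates x gs)

record Extension {m g : ℕ} (gs : Gates m g) (d : ℕ) : Set where
  field
    newCount   : ℕ
    newGates   : Gates m newCount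
    newCount≡  : newCount ≡ g + d
    lift       : Wire m g → Wire m newCount
    lift-sound : ∀ x w → ⟦ newGates ⟧ x (lift w) ≡ ⟦ gs ⟧ x w
open Extension

Built : ∀ {m g} → Gates m g → ℕ → (ℕ → Set) → Set
Built gs d Res = Σ (Extension gs d) λ E → Res (newCount E)

module _ {m : ℕ} where

  unchanged : ∀ {g} {gs : Gates m g} → Extension gs 0
  unchanged {g} {gs} = record
    { newCount = g ; newGates = gs ; newCount≡ = sym (+-identityʳ g)
    ; lift = λ w → w ; lift-sound = λ _ _ → refl }

  _⊕_ : ∀ {g d₁ d₂} {gs : Gates m g} (E₁ : Extension gs d₁) →
        Extension (newGates E₁) d₂ → Extension gs (d₁ + d₂)
  _⊕_ {g} {d₁} {d₂} E₁ E₂ = record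
    { newCount = newCount E₂ ; newGates = newGates E₂
    ; newCount≡ = trans (newCount≡ E₂) (trans (cong (_+ d₂) (newCount≡ E₁)) (+-assoc g d₁ d₂))
    ; lift = lift E₂ ∘ lift E₁
    ; lift-sound = λ x w → trans (lift-sound E₂ x (lift E₁ w)) (lift-sound E₁ x w) }

  weaken : ∀ {g} → Wire m g → Wire m (suc g)
  weaken (input i) = input i
  weaken (gate j)  = gate (Fin.suc j)
  weaken (const b) = const b

  -- append one gate; its output is the wire  gate zero
  snoc : ∀ {g} {gs : Gates m g} → Gate m g → Extension gs 1
  snoc {g} {gs} γ = record
    { newCount = suc g ; newGates = gs ▷ γ ; newCount≡ = +-comm 1 g
    ; lift = weaken ; lift-sound = weaken-sound }
    where
    weaken-sound : ∀ x w → ⟦ gs ▷ γ ⟧ x (weaken w) ≡ ⟦ gs ⟧ x w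
    weaken-sound x (input i) = refl
    weaken-sound x (gate j)  = refl
    weaken-sound x (const b) = refl

  -- Dual-rail representation of a valuation of U: a wire for every u and
  -- one for its negation.
  record Rails (g : ℕ) (U : Set) : Set where
    constructor rails
    field
      hi lo : U → Wire m g
  open Rails public

  liftRails : ∀ {g d U} {gs : Gates m g} (E : Extension gs d) → Rails g U → Rails (newCount E) U
  liftRails E r = rails (lift E ∘ hi r) (lift E ∘ lo r)

  Carries : ∀ {g U} → (Fin m → Bool) → Gates m g → Rails g U → (U → Bool) → Set
  Carries x gs r val = (∀ u → ⟦ gs ⟧ x (hi r u) ≡ val u) × (∀ u → ⟦ gs ⟧ x (lo r u) ≡ not (val u))

  liftRails-carries : ∀ {g d U x val} {gs : Gates m g} (E : Extension gs d) {r : Rails g U} →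
                      Carries x gs r val → Carries x (newGates E) (liftRails E r) val
  liftRails-carries E (hi≡ , lo≡) =
    (λ u → trans (lift-sound E _ _) (hi≡ u)) , (λ u → trans (lift-sound E _ _) (lo≡ u))

  valueOf : ∀ {g d} {gs : Gates m g} → (Fin m → Bool) → Built gs d (Wire m) → Bool
  valueOf x (E , w) = ⟦ newGates E ⟧ x w

  join : ∀ {g d₁ d₂} {gs : Gates m g} → (∀ {h} → Wire m h → Wire m h → Gate m h) →
         (c₁ : Built gs d₁ (Wire m)) → Built (newGates (proj₁ c₁)) d₂ (Wire m) →
         Built gs (d₁ + d₂ + 1) (Wire m)
  join op (E₁ , w₁) (E₂ , w₂) = (E₁ ⊕ E₂) ⊕ snoc (op (lift E₂ w₁) w₂) , gate Fin.zero

  compile : ∀ {g X} (gs : Gates m g) → Rails g X → (f : NNF X) → Built gs (nnfSize f) (Wire m)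
  compile gs r (var x)   = unchanged , hi r x
  compile gs r (nvar x)  = unchanged , lo r x
  compile gs r (cst b)   = unchanged , const b
  compile gs r (and a b) = let c = compile gs r a in
    join AND c (compile (newGates (proj₁ c)) (liftRails (proj₁ c) r) b)
  compile gs r (or a b)  = let c = compile gs r a in
    join OR c (compile (newGates (proj₁ c)) (liftRails (proj₁ c) r) b)

  compile-sound : ∀ {g X x val} {gs : Gates m g} {r : Rails g X} → Carries x gs r val →
                  ∀ f → valueOf x (compile gs r f) ≡ evalNNF val f
  compile-sound c (var x)   = proj₁ c x
  compile-sound c (nvar x)  = proj₂ c x
  compile-sound c (cst b)   = refl
  compile-sound {x = x} {gs = gs} {r} c (and a b) = cong₂ _∧_
    (trans (lift-sound (proj₁ (compile _ _ b)) x _) (compile-sound c a))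
    (compile-sound (liftRails-carries (proj₁ (compile gs r a)) c) b)
  compile-sound {x = x} {gs = gs} {r} c (or a b) = cong₂ _∨_
    (trans (lift-sound (proj₁ (compile _ _ b)) x _) (compile-sound c a))
    (compile-sound (liftRails-carries (proj₁ (compile gs r a)) c) b)

-- t-fold iteration, consuming steps from the front like  exec  does
iterate : ∀ {A : Set} → (A → A) → ℕ → A → A
iterate h zero    a = a
iterate h (suc t) a = iterate h t (h a)

update : ∀ {X U : Set} → (U → NNF X) → (X → Bool) → (U → Bool)
update f v u = evalNNF v (f u)

module Layers {U : Set} (coords : List U) (complete : ∀ u → u ∈ coords) {m : ℕ} where

  compileAll : ∀ {g X} (gs : Gates m g) → Rails g X → (f : U → NNF X) (us : List U) →
               Built gs (cost f us) (λ h → ∀ {u} → u ∈ us → Wire m h)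
  compileAll gs r f []       = unchanged , λ ()
  compileAll gs r f (u ∷ us) =
    let (E₁ , w) = compile gs r (f u)
        (E₂ , ws) = compileAll (newGates E₁) (liftRails E₁ r) f us
    in E₁ ⊕ E₂ , λ { (here refl) → lift E₂ w ; (there p) → ws p }

  compileAll-sound : ∀ {g X x val} {gs : Gates m g} {r : Rails g X} → Carries x gs r val →
    ∀ f us {u} (p : u ∈ us) →
    ⟦ newGates (proj₁ (compileAll gs r f us)) ⟧ x (proj₂ (compileAll gs r f us) p) ≡ evalNNF val (f u)
  compileAll-sound {x = x} c f (u ∷ us) (here refl) =
    trans (lift-sound (proj₁ (compileAll _ _ f us)) x _) (compile-sound c (f u))
  compileAll-sound {gs = gs} {r} c f (u ∷ us) (there p) =
    compileAll-sound (liftRails-carries (proj₁ (compile gs r (f u))) c) f us p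

  layerCost : ∀ {X} → (U → NNF X) → ℕ
  layerCost f = cost f coords + cost (dual ∘ f) coords

  layerCost-≤ : ∀ {X} (f : U → NNF X) {B} → (∀ u → nnfSize (f u) ≤ B) →
                layerCost f ≤ length coords * B + length coords * B
  layerCost-≤ f f≤B = +-mono-≤ (cost-≤ f coords f≤B)
    (cost-≤ (dual ∘ f) coords (λ u → subst (_≤ _) (sym (nnfSize-dual (f u))) (f≤B u)))

  layer : ∀ {g X} (gs : Gates m g) → Rails g X → (f : U → NNF X) →
          Built gs (layerCost f) (λ h → Rails {m} h U)
  layer gs r f =
    let (E₁ , his) = compileAll gs r f coords
        (E₂ , los) = compileAll (newGates E₁) (liftRails E₁ r) (dual ∘ f) coords
    in E₁ ⊕ E₂ , rails (λ u → lift E₂ (his (complete u))) (λ u → los (complete u))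

  layer-sound : ∀ {g X x val} {gs : Gates m g} {r : Rails g X} → Carries x gs r val →
    ∀ f → Carries x (newGates (proj₁ (layer gs r f))) (proj₂ (layer gs r f)) (update f val)
  layer-sound {x = x} {val} {gs} {r} c f =
    (λ u → trans (lift-sound (proj₁ los) x _) (compileAll-sound c f coords (complete u))) ,
    (λ u → trans (compileAll-sound (liftRails-carries (proj₁ his) c) (dual ∘ f) coords (complete u))
                 (evalNNF-dual val (f u)))
    where
    his : Built gs (cost f coords) (λ h → ∀ {u} → u ∈ coords → Wire m h)
    his = compileAll gs r f coords
    los : Built (newGates (proj₁ his)) (cost (dual ∘ f) coords) (λ h → ∀ {u} → u ∈ coords → Wire m h)
    los = compileAll (newGates (proj₁ his)) (liftRails (proj₁ his) r) (dual ∘ f) coords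

  layers : ∀ {g} (t : ℕ) (gs : Gates m g) → Rails {m} g U → (f : U → NNF U) →
           Built gs (t * layerCost f) (λ h → Rails {m} h U)
  layers zero    gs r f = unchanged , r
  layers (suc t) gs r f =
    let (E₁ , r₁) = layer gs r f
        (E₂ , r₂) = layers t (newGates E₁) r₁ f
    in E₁ ⊕ E₂ , r₂

  layers-sound : ∀ {g x val} (t : ℕ) {gs : Gates m g} {r : Rails {m} g U} → Carries x gs r val →
    ∀ f → Carries x (newGates (proj₁ (layers t gs r f))) (proj₂ (layers t gs r f)) (iterate (update f) t val)
  layers-sound zero    c f = c
  layers-sound (suc t) c f = layers-sound t (layer-sound c f) f

-- In  flat w,  position 2i carries ¬wᵢ and position 2i+1 carries wᵢ: the
-- flattened word is exactly a dual-rail encoding of w.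
posIndex negIndex : ∀ {n} → Fin n → Fin (n * 2)
posIndex Fin.zero    = Fin.suc Fin.zero
posIndex (Fin.suc i) = Fin.suc (Fin.suc (posIndex i))
negIndex Fin.zero    = Fin.zero
negIndex (Fin.suc i) = Fin.suc (Fin.suc (negIndex i))

inputRails : ∀ {n} → Rails {n * 2} 0 (Fin n)
inputRails = rails (input ∘ posIndex) (input ∘ negIndex)

inputRails-carries : ∀ {n} (v : Vec Bool n) → Carries (lookup (flat v)) [] inputRails (lookup v)
inputRails-carries v = flat-pos v , flat-neg v
  where
  flat-pos : ∀ {n} (v : Vec Bool n) i → lookup (flat v) (posIndex i) ≡ lookup v i
  flat-pos (b ∷ v) Fin.zero    = refl
  flat-pos (b ∷ v) (Fin.suc i) = flat-pos v i
  flat-neg : ∀ {n} (v : Vec Bool n) i → lookup (flat v) (negIndex i) ≡ not (lookup v i)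
  flat-neg (b ∷ v) Fin.zero    = refl
  flat-neg (b ∷ v) (Fin.suc i) = flat-neg v i

module IteratedCircuit {U : Set} (coords : List U) (complete : ∀ u → u ∈ coords) (n : ℕ)
                       (f₀ : U → NNF (Fin n)) (f : U → NNF U) (t : ℕ) where
  open Layers coords complete {n * 2}

  private
    first : Built [] (layerCost f₀) (λ h → Rails h U)
    first = layer [] inputRails f₀
    rest : Built (newGates (proj₁ first)) (t * layerCost f) (λ h → Rails h U)
    rest = layers t (newGates (proj₁ first)) (proj₂ first) f

  circuit : U → MonCircuit (n * 2)
  circuit out = record
    { size = newCount (proj₁ rest) ; gates = newGates (proj₁ rest) ; output = hi (proj₂ rest) out }

  circuit-size : ∀ out → size (circuit out) ≡ layerCost f₀ + t * layerCost f
  circuit-size out = newCount≡ (proj₁ first ⊕ proj₁ rest)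

  circuit-sound : ∀ out (v : Vec Bool n) →
    eval (circuit out) (lookup (flat v)) ≡ iterate (update f) t (update f₀ (lookup v)) out
  circuit-sound out v = proj₁ (layers-sound t (layer-sound (inputRails-carries v) f₀) f) out

-- Size bookkeeping for formulas: with every disjunction ranging over at
-- most Z = 3 + z alternatives, each formula constructor raises the size
-- bound Z ^ k by a fixed number of powers of Z.
module FormulaBounds (z : ℕ) where
  Z : ℕ
  Z = 3 + z

  raise : ∀ {a} k k′ → a ≤ Z ^ k → k ≤ k′ → a ≤ Z ^ k′
  raise k k′ a≤ k≤k′ = ≤-trans a≤ (^-monoʳ-≤ Z k≤k′)

  binary-≤ : ∀ {a b} k → a ≤ Z ^ k → b ≤ Z ^ k → a + b + 1 ≤ Z ^ suc k
  binary-≤ {a} {b} k a≤ b≤ = subst (_≤ Z ^ suc k) (sym (+-assoc a b 1))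
    (+-mono-≤ a≤ (+-mono-≤ b≤ (≤-trans (m^n>0 Z k) (m≤m+n (Z ^ k) _))))

  ⋁-≤ : ∀ {X A : Set} (as : List A) (f : A → NNF X) k → length as ≤ Z →
        (∀ a → nnfSize (f a) ≤ Z ^ k) → nnfSize (⋁ as f) ≤ Z ^ (2 + k)
  ⋁-≤ as f k as≤Z f≤ = ≤-trans (by-length as) (*-mono-≤ as≤Z 1+Z^k≤Z^[1+k])
    where
    1+Z^k≤Z^[1+k] : suc (Z ^ k) ≤ Z ^ suc k
    1+Z^k≤Z^[1+k] = ≤-trans (+-monoˡ-≤ (Z ^ k) (m^n>0 Z k)) (+-monoʳ-≤ (Z ^ k) (m≤m+n (Z ^ k) _))
    by-length : ∀ as → nnfSize (⋁ as f) ≤ length as * suc (Z ^ k)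
    by-length []       = z≤n
    by-length (a ∷ as) = subst (_≤ suc (Z ^ k) + length as * suc (Z ^ k)) (sym (+-comm _ 1))
                           (s≤s (+-mono-≤ (f≤ a) (by-length as)))

≡ᵇ-true : ∀ {m n} → m ≡ n → (m ≡ᵇ n) ≡ true
≡ᵇ-true {m} {n} m≡n = Equivalence.to T-≡ (≡⇒≡ᵇ m n m≡n)

≡ᵇ-sound : ∀ {m n} → (m ≡ᵇ n) ≡ true → m ≡ n
≡ᵇ-sound {m} {n} m≡ᵇn = ≡ᵇ⇒≡ m n (Equivalence.from T-≡ m≡ᵇn)

-- One-hot selection: if h is true exactly at x₀ ∈ xs, the h-guarded
-- disjunction of g over xs is g x₀.  This is how a circuit reads the value
-- of a one-hot encoded quantity.
select : ∀ {A : Set} (h g : A → Bool) {x₀ : A} {xs : List A} → x₀ ∈ xs →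
         h x₀ ≡ true → (∀ x → h x ≡ true → x ≡ x₀) → any (λ x → h x ∧ g x) xs ≡ g x₀
select h g {x₀} {xs} x₀∈xs hx₀ unique with g x₀ in gx₀
... | true  = hit {xs} x₀∈xs
  where
  hit : ∀ {xs} → x₀ ∈ xs → any (λ x → h x ∧ g x) xs ≡ true
  hit (here refl) rewrite hx₀ | gx₀ = refl
  hit {y ∷ ys} (there p) rewrite hit p = ∨-zeroʳ (h y ∧ g y)
... | false = miss xs
  where
  off : ∀ y → h y ∧ g y ≡ false
  off y with h y in hy
  ... | false = refl
  ... | true  = trans (cong g (unique y hy)) gx₀
  miss : ∀ xs → any (λ x → h x ∧ g x) xs ≡ false
  miss []       = refl
  miss (y ∷ ys) rewrite miss ys = trans (∨-identityʳ _) (off y)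

selectFin : ∀ {k} (z : ℕ) (z<k : z < k) (g : Fin k → Bool) →
            any (λ i → (toℕ i ≡ᵇ z) ∧ g i) (allFin k) ≡ g (fromℕ< z<k)
selectFin z z<k g = select _ g (∈-allFin _) (≡ᵇ-true (toℕ-fromℕ< z<k))
  (λ i i≡ᵇz → toℕ-injective (trans (≡ᵇ-sound i≡ᵇz) (sym (toℕ-fromℕ< z<k))))

symCode : InSym → ℕ
symCode lend        = 0
symCode rend        = 1
symCode (bit false) = 2
symCode (bit true)  = 3

sameSym : InSym → InSym → Bool
sameSym s s′ = symCode s ≡ᵇ symCode s′

sameSym-refl : ∀ s → sameSym s s ≡ true
sameSym-refl s = ≡ᵇ-true {symCode s} refl

sameSym-sound : ∀ s s′ → sameSym s s′ ≡ true → s ≡ s′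
sameSym-sound s s′ eq = trans (sym (decode-code s)) (trans (cong decode (≡ᵇ-sound eq)) (decode-code s′))
  where
  decode : ℕ → InSym
  decode 0 = lend
  decode 1 = rend
  decode 2 = bit false
  decode _ = bit true
  decode-code : ∀ s → decode (symCode s) ≡ s
  decode-code lend        = refl
  decode-code rend        = refl
  decode-code (bit false) = refl
  decode-code (bit true)  = refl

symbols : List InSym
symbols = lend ∷ rend ∷ bit false ∷ bit true ∷ []

symbols-complete : ∀ s → s ∈ symbols
symbols-complete lend        = here refl
symbols-complete rend        = there (here refl)
symbols-complete (bit false) = there (there (here refl))
symbols-complete (bit true)  = there (there (there (here refl)))

moveIn-< : ∀ k mi p → p < 2 + k → moveIn k mi p < 2 + k
moveIn-< k L p p< = ≤-<-trans pred[n]≤n p<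
moveIn-< k S p p< = p<
moveIn-< k R p p< with p ≤ᵇ k in p≤ᵇk
... | true  = s≤s (s≤s (≤ᵇ⇒≤ p k (Equivalence.from T-≡ p≤ᵇk)))
... | false = p<

moveW-≤ : ∀ mw p τ → p ≤ τ → moveW mw p ≤ suc τ
moveW-≤ L p τ p≤ = ≤-trans pred[n]≤n (m≤n⇒m≤1+n p≤)
moveW-≤ S p τ p≤ = m≤n⇒m≤1+n p≤
moveW-≤ R p τ p≤ = s≤s p≤

length-cartesianProductWith : ∀ {A B C : Set} (f : A → B → C) xs ys →
  length (cartesianProductWith f xs ys) ≡ length xs * length ys
length-cartesianProductWith f []       ys = refl
length-cartesianProductWith f (x ∷ xs) ys =
  trans (length-++ (map (f x) ys)) (cong₂ _+_ (length-map (f x) ys) (length-cartesianProductWith f xs ys))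

module Simulation (M : Machine) (n T : ℕ) where
  open Machine M

  data Coord : Set where
    stateIs         : Fin Q → Coord
    inHeadAt        : Fin (2 + n) → Coord
    workHeadAt      : Fin (suc T) → Coord
    cellHolds       : Fin (suc T) → Fin (suc Γ) → Coord
    inputBit        : Fin n → Coord
    halted accepted : Coord

  stateCoords headCoords cellCoords inputCoords flagCoords : List Coord
  stateCoords = map stateIs (allFin Q)
  headCoords  = map inHeadAt (allFin (2 + n)) ++ map workHeadAt (allFin (suc T))
  cellCoords  = cartesianProductWith cellHolds (allFin (suc T)) (allFin (suc Γ))
  inputCoords = map inputBit (allFin n)
  flagCoords  = halted ∷ accepted ∷ []

  coords : List Coord
  coords = stateCoords ++ headCoords ++ cellCoords ++ inputCoords ++ flagCoords

  coords-complete : ∀ u → u ∈ coords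
  coords-complete (stateIs q)     = ∈-++⁺ˡ (∈-map⁺ stateIs (∈-allFin q))
  coords-complete (inHeadAt p)    = ∈-++⁺ʳ stateCoords (∈-++⁺ˡ (∈-++⁺ˡ (∈-map⁺ inHeadAt (∈-allFin p))))
  coords-complete (workHeadAt j)  = ∈-++⁺ʳ stateCoords (∈-++⁺ˡ (∈-++⁺ʳ (map inHeadAt (allFin (2 + n)))
    (∈-map⁺ workHeadAt (∈-allFin j))))
  coords-complete (cellHolds j a) = ∈-++⁺ʳ stateCoords (∈-++⁺ʳ headCoords (∈-++⁺ˡ
    (∈-cartesianProductWith⁺ cellHolds (∈-allFin j) (∈-allFin a))))
  coords-complete (inputBit i)    = ∈-++⁺ʳ stateCoords (∈-++⁺ʳ headCoords (∈-++⁺ʳ cellCoords (∈-++⁺ˡ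
    (∈-map⁺ inputBit (∈-allFin i)))))
  coords-complete halted          = ∈-++⁺ʳ stateCoords (∈-++⁺ʳ headCoords (∈-++⁺ʳ cellCoords
    (∈-++⁺ʳ inputCoords (here refl))))
  coords-complete accepted        = ∈-++⁺ʳ stateCoords (∈-++⁺ʳ headCoords (∈-++⁺ʳ cellCoords
    (∈-++⁺ʳ inputCoords (there (here refl)))))

  bitIs : Coord → InSym → NNF Coord
  bitIs u (bit true)  = var u
  bitIs u (bit false) = nvar u
  bitIs u _           = cst false

  symbolAt : ∀ {k} → (Fin k → Coord) → ℕ → InSym → NNF Coord
  symbolAt ι zero s = cst (sameSym s lend)
  symbolAt {zero}  ι (suc p)       s = cst (sameSym s rend)
  symbolAt {suc k} ι (suc zero)    s = bitIs (ι Fin.zero) s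
  symbolAt {suc k} ι (suc (suc p)) s = symbolAt (ι ∘ Fin.suc) (suc p) s

  readsInput : InSym → NNF Coord
  readsInput s = ⋁ (allFin (2 + n)) λ p → and (var (inHeadAt p)) (symbolAt inputBit (toℕ p) s)

  readsWork : Fin (suc Γ) → NNF Coord
  readsWork a = ⋁ (allFin (suc T)) λ j → and (var (workHeadAt j)) (var (cellHolds j a))

  onWorkSymbol : (Action Q Γ → NNF Coord) → Fin Q → InSym → NNF Coord
  onWorkSymbol G q s = ⋁ (allFin (suc Γ)) λ a → and (readsWork a) (G (δ q s a))

  onInputSymbol : (Action Q Γ → NNF Coord) → Fin Q → NNF Coord
  onInputSymbol G q = ⋁ symbols λ s → and (readsInput s) (onWorkSymbol G q s)

  dispatch : (Action Q Γ → NNF Coord) → NNF Coord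
  dispatch G = ⋁ (allFin Q) λ q → and (var (stateIs q)) (onInputSymbol G q)

  next : Coord → Action Q Γ → NNF Coord
  next halted   (halt b)              = cst true
  next accepted (halt b)              = cst b
  next (inputBit i) _                 = var (inputBit i)
  next (stateIs q′) (go q _ _ _ _)    = cst (toℕ q′ ≡ᵇ toℕ q)
  next (inHeadAt i) (go _ _ mi _ _)   =
    ⋁ (allFin (2 + n)) λ p → and (var (inHeadAt p)) (cst (toℕ i ≡ᵇ moveIn n mi (toℕ p)))
  next (workHeadAt j) (go _ _ _ mw _) =
    ⋁ (allFin (suc T)) λ p → and (var (workHeadAt p)) (cst (toℕ j ≡ᵇ moveW mw (toℕ p)))
  next (cellHolds j a′) (go _ a _ _ _) =
    or (and (var (workHeadAt j)) (cst (toℕ a′ ≡ᵇ toℕ a))) (and (nvar (workHeadAt j)) (var (cellHolds j a′)))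
  next _ _                            = cst false

  frozen : Coord → NNF Coord
  frozen halted       = cst true
  frozen accepted     = var accepted
  frozen (inputBit i) = var (inputBit i)
  frozen _            = cst false

  stepFormula : Coord → NNF Coord
  stepFormula u = or (and (var halted) (frozen u)) (and (nvar halted) (dispatch (next u)))

  initFormula : Coord → NNF (Fin n)
  initFormula (stateIs q)     = cst (toℕ q ≡ᵇ toℕ start)
  initFormula (inHeadAt p)    = cst (toℕ p ≡ᵇ 1)
  initFormula (workHeadAt j)  = cst (toℕ j ≡ᵇ 0)
  initFormula (cellHolds j a) = cst (toℕ a ≡ᵇ 0)
  initFormula (inputBit i)    = var i
  initFormula halted          = cst false
  initFormula accepted        = cst false

  module Run (v : Vec Bool n) where
    w : List Bool
    w = toList v

    -- the intended valuation of the coordinates for a status of M: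
    -- one-hot encodings of state, head positions and cell contents
    encode : Status M → Coord → Bool
    encode s (inputBit i)                = lookup v i
    encode (done b c) halted             = true
    encode (done b c) accepted           = b
    encode (done b c) _                  = false
    encode (running c) (stateIs q)       = toℕ q ≡ᵇ toℕ (Config.state c)
    encode (running c) (inHeadAt p)      = toℕ p ≡ᵇ Config.inPos c
    encode (running c) (workHeadAt j)    = toℕ j ≡ᵇ Config.wPos c
    encode (running c) (cellHolds j a)   = toℕ a ≡ᵇ toℕ (Config.tape c (toℕ j))
    encode (running c) _                 = false

    initFormula-sound : update initFormula (lookup v) ≗ encode (running (initial M))
    initFormula-sound (stateIs q)     = refl
    initFormula-sound (inHeadAt p)    = refl
    initFormula-sound (workHeadAt j)  = refl
    initFormula-sound (cellHolds j a) = refl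
    initFormula-sound (inputBit i)    = refl
    initFormula-sound halted          = refl
    initFormula-sound accepted        = refl

    -- the status reached when the running configuration c performs act;
    -- this is the body of  step
    perform : Config M → Action Q Γ → Status M
    perform c (halt b)         = done b c
    perform c (go q a mi mw o) = running (cfg q
      (moveIn (length w) mi (Config.inPos c))
      (λ j → if j ≡ᵇ Config.wPos c then a else Config.tape c j)
      (moveW mw (Config.wPos c))
      (Config.maxPos c ⊔ moveW mw (Config.wPos c))
      (appendOut o (Config.out c)))

    step≡perform : ∀ c →
      step M w c ≡ perform c (δ (Config.state c) (readIn w (Config.inPos c)) (Config.tape c (Config.wPos c)))
    step≡perform c with δ (Config.state c) (readIn w (Config.inPos c)) (Config.tape c (Config.wPos c))
    ... | halt b         = refl
    ... | go q a mi mw o = refl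

    -- The formulas read a running configuration correctly as long as both
    -- heads lie in the encoded range.
    module Reading (c : Config M) (inPos< : Config.inPos c < 2 + n) (wPos< : Config.wPos c < suc T) where
      open Config c

      enc : Coord → Bool
      enc = encode (running c)

      bitIs-sound : ∀ u s → evalNNF enc (bitIs u s) ≡ sameSym s (bit (enc u))
      bitIs-sound u lend        with enc u
      ... | true  = refl
      ... | false = refl
      bitIs-sound u rend        with enc u
      ... | true  = refl
      ... | false = refl
      bitIs-sound u (bit true)  with enc u
      ... | true  = refl
      ... | false = refl
      bitIs-sound u (bit false) with enc u
      ... | true  = refl
      ... | false = refl

      symbolAt-sound : ∀ {k} (ι : Fin k → Coord) (bs : Vec Bool k) → (∀ i → enc (ι i) ≡ lookup bs i) →
                       ∀ p s → evalNNF enc (symbolAt ι p s) ≡ sameSym s (readIn (toList bs) p)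
      symbolAt-sound ι bs       ι≡ zero          s = refl
      symbolAt-sound ι []       ι≡ (suc p)       s = refl
      symbolAt-sound ι (b ∷ bs) ι≡ (suc zero)    s =
        trans (bitIs-sound (ι Fin.zero) s) (cong (λ b → sameSym s (bit b)) (ι≡ Fin.zero))
      symbolAt-sound ι (b ∷ bs) ι≡ (suc (suc p)) s = symbolAt-sound (ι ∘ Fin.suc) bs (ι≡ ∘ Fin.suc) (suc p) s

      inputSym : InSym
      inputSym = readIn w inPos

      readsInput-sound : ∀ s → evalNNF enc (readsInput s) ≡ sameSym s inputSym
      readsInput-sound s = begin
        evalNNF enc (readsInput s)
          ≡⟨ evalNNF-⋁ enc (allFin (2 + n)) (λ p → and (var (inHeadAt p)) (symbolAt inputBit (toℕ p) s)) ⟩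
        any (λ p → (toℕ p ≡ᵇ inPos) ∧ evalNNF enc (symbolAt inputBit (toℕ p) s)) (allFin (2 + n))
          ≡⟨ selectFin inPos inPos< (λ p → evalNNF enc (symbolAt inputBit (toℕ p) s)) ⟩
        evalNNF enc (symbolAt inputBit (toℕ (fromℕ< inPos<)) s)
          ≡⟨ cong (λ p → evalNNF enc (symbolAt inputBit p s)) (toℕ-fromℕ< inPos<) ⟩
        evalNNF enc (symbolAt inputBit inPos s)
          ≡⟨ symbolAt-sound inputBit v (λ _ → refl) inPos s ⟩
        sameSym s inputSym ∎
        where open ≡-Reasoning

      readsWork-sound : ∀ a → evalNNF enc (readsWork a) ≡ (toℕ a ≡ᵇ toℕ (tape wPos))
      readsWork-sound a =
        trans (evalNNF-⋁ enc (allFin (suc T)) (λ j → and (var (workHeadAt j)) (var (cellHolds j a))))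
          (trans (selectFin wPos wPos< (λ j → toℕ a ≡ᵇ toℕ (tape (toℕ j))))
            (cong (λ j → toℕ a ≡ᵇ toℕ (tape j)) (toℕ-fromℕ< wPos<)))

      dispatch-sound : ∀ G → evalNNF enc (dispatch G) ≡ evalNNF enc (G (δ state inputSym (tape wPos)))
      dispatch-sound G = begin
        evalNNF enc (dispatch G)
          ≡⟨ evalNNF-⋁ enc (allFin Q) (λ q → and (var (stateIs q)) (onInputSymbol G q)) ⟩
        any (λ q → (toℕ q ≡ᵇ toℕ state) ∧ evalNNF enc (onInputSymbol G q)) (allFin Q)
          ≡⟨ selectFin (toℕ state) (toℕ<n state) (evalNNF enc ∘ onInputSymbol G) ⟩
        evalNNF enc (onInputSymbol G (fromℕ< (toℕ<n state)))
          ≡⟨ cong (evalNNF enc ∘ onInputSymbol G) (fromℕ<-toℕ state (toℕ<n state)) ⟩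
        evalNNF enc (onInputSymbol G state)
          ≡⟨ evalNNF-⋁ enc symbols (λ s → and (readsInput s) (onWorkSymbol G state s)) ⟩
        any (λ s → evalNNF enc (readsInput s) ∧ evalNNF enc (onWorkSymbol G state s)) symbols
          ≡⟨ select (evalNNF enc ∘ readsInput) (evalNNF enc ∘ onWorkSymbol G state) (symbols-complete inputSym)
               (trans (readsInput-sound inputSym) (sameSym-refl inputSym))
               (λ s hs → sameSym-sound s inputSym (trans (sym (readsInput-sound s)) hs)) ⟩
        evalNNF enc (onWorkSymbol G state inputSym)
          ≡⟨ evalNNF-⋁ enc (allFin (suc Γ)) (λ a → and (readsWork a) (G (δ state inputSym a))) ⟩
        any (λ a → evalNNF enc (readsWork a) ∧ evalNNF enc (G (δ state inputSym a))) (allFin (suc Γ))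
          ≡⟨ select (evalNNF enc ∘ readsWork) (λ a → evalNNF enc (G (δ state inputSym a))) (∈-allFin (tape wPos))
               (trans (readsWork-sound (tape wPos)) (≡ᵇ-true {toℕ (tape wPos)} refl))
               (λ a ha → toℕ-injective (≡ᵇ-sound (trans (sym (readsWork-sound a)) ha))) ⟩
        evalNNF enc (G (δ state inputSym (tape wPos))) ∎
        where open ≡-Reasoning

      next-sound : ∀ act u → evalNNF enc (next u act) ≡ encode (perform c act) u
      next-sound (halt b) halted            = refl
      next-sound (halt b) accepted          = refl
      next-sound (halt b) (inputBit i)      = refl
      next-sound (halt b) (stateIs q)       = refl
      next-sound (halt b) (inHeadAt p)      = refl
      next-sound (halt b) (workHeadAt j)    = refl
      next-sound (halt b) (cellHolds j a)   = refl
      next-sound (go q a mi mw o) halted         = refl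
      next-sound (go q a mi mw o) accepted       = refl
      next-sound (go q a mi mw o) (inputBit i)   = refl
      next-sound (go q a mi mw o) (stateIs q′)   = refl
      next-sound (go q a mi mw o) (inHeadAt p)   =
        trans (evalNNF-⋁ enc (allFin (2 + n))
                 λ p′ → and (var (inHeadAt p′)) (cst (toℕ p ≡ᵇ moveIn n mi (toℕ p′))))
          (trans (selectFin inPos inPos< λ p′ → toℕ p ≡ᵇ moveIn n mi (toℕ p′))
            (cong₂ (λ len pos → toℕ p ≡ᵇ moveIn len mi pos) (sym (length-toList v)) (toℕ-fromℕ< inPos<)))
      next-sound (go q a mi mw o) (workHeadAt j) =
        trans (evalNNF-⋁ enc (allFin (suc T))
                 λ j′ → and (var (workHeadAt j′)) (cst (toℕ j ≡ᵇ moveW mw (toℕ j′))))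
          (trans (selectFin wPos wPos< λ j′ → toℕ j ≡ᵇ moveW mw (toℕ j′))
            (cong (λ pos → toℕ j ≡ᵇ moveW mw pos) (toℕ-fromℕ< wPos<)))
      next-sound (go q a mi mw o) (cellHolds j a′) with toℕ j ≡ᵇ wPos
      ... | true  = ∨-identityʳ _
      ... | false = refl

    advance : Status M → Status M
    advance (done b c)  = done b c
    advance (running c) = step M w c

    exec≡iterate : ∀ t c → exec M w t c ≡ iterate advance t (running c)
    exec≡iterate zero    c = refl
    exec≡iterate (suc t) c with step M w c
    ... | done b c′  = sym (iterate-done t)
      where
      iterate-done : ∀ t → iterate advance t (done b c′) ≡ done b c′
      iterate-done zero    = refl
      iterate-done (suc t) = iterate-done t
    ... | running c′ = exec≡iterate t c′

    Bounded : ℕ → Status M → Set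
    Bounded τ (done b c)  = ⊤
    Bounded τ (running c) = Config.inPos c < 2 + n × Config.wPos c ≤ τ

    advance-bounded : ∀ τ s → Bounded τ s → Bounded (suc τ) (advance s)
    advance-bounded τ (done b c)  _                = tt
    advance-bounded τ (running c) (inPos< , wPos≤) rewrite step≡perform c = perform-bounded _
      where
      perform-bounded : ∀ act → Bounded (suc τ) (perform c act)
      perform-bounded (halt b)         = tt
      perform-bounded (go q a mi mw o) =
        subst (λ len → moveIn len mi (Config.inPos c) < 2 + n) (sym (length-toList v)) (moveIn-< n mi _ inPos<) ,
        moveW-≤ mw _ τ wPos≤

    stepFormula-sound : ∀ τ s → Bounded τ s → τ ≤ T → update stepFormula (encode s) ≗ encode (advance s)
    stepFormula-sound τ (done b c) _ _ u = trans (∨-identityʳ _) (frozen-sound u)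
      where
      frozen-sound : ∀ u → evalNNF (encode (done b c)) (frozen u) ≡ encode (done b c) u
      frozen-sound (stateIs q)     = refl
      frozen-sound (inHeadAt p)    = refl
      frozen-sound (workHeadAt j)  = refl
      frozen-sound (cellHolds j a) = refl
      frozen-sound (inputBit i)    = refl
      frozen-sound halted          = refl
      frozen-sound accepted        = refl
    stepFormula-sound τ (running c) (inPos< , wPos≤) τ≤T u = begin
      evalNNF enc (dispatch (next u))  ≡⟨ dispatch-sound (next u) ⟩
      evalNNF enc (next u act)         ≡⟨ next-sound act u ⟩
      encode (perform c act) u         ≡⟨ cong (λ s → encode s u) (sym (step≡perform c)) ⟩
      encode (step M w c) u            ∎
      where
      open ≡-Reasoning
      open Reading c inPos< (s≤s (≤-trans wPos≤ τ≤T))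
      act : Action Q Γ
      act = δ (Config.state c) inputSym (Config.tape c (Config.wPos c))

    simulate : ∀ t τ s val → τ + t ≤ T → Bounded τ s → val ≗ encode s →
               iterate (update stepFormula) t val ≗ encode (iterate advance t s)
    simulate zero    τ s val _      _  val≗ = val≗
    simulate (suc t) τ s val τ+t≤T bd val≗ =
      simulate t (suc τ) (advance s) (update stepFormula val) (subst (_≤ T) (+-suc τ t) τ+t≤T)
        (advance-bounded τ s bd)
        (λ u → trans (evalNNF-cong val≗ (stepFormula u))
                     (stepFormula-sound τ s bd (≤-trans (m≤m+n τ (suc t)) τ+t≤T) u))

    simulation-correct : ∀ b cf → HaltsWithin M w T b cf →
      iterate (update stepFormula) T (update initFormula (lookup v)) accepted ≡ b
    simulation-correct b cf halts =
      trans (simulate T 0 (running (initial M)) _ ≤-refl (s≤s (s≤s z≤n) , z≤n) initFormula-sound accepted)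
            (cong (λ s → encode s accepted) (trans (sym (exec≡iterate T (initial M))) halts))

  -- Size bounds: all disjunctions range over at most Z = 3 + width alternatives.
  width : ℕ
  width = suc (Q + (2 + n + (suc T + suc Γ)))

  open FormulaBounds width

  allFin-≤ : ∀ k → k ≤ Q + (2 + n + (suc T + suc Γ)) → length (allFin k) ≤ Z
  allFin-≤ k k≤ = subst (_≤ Z) (sym (length-tabulate (λ i → i))) (≤-trans k≤ (m≤n+m _ 4))

  states≤ : length (allFin Q) ≤ Z
  states≤ = allFin-≤ Q (m≤m+n Q _)

  inPositions≤ : length (allFin (2 + n)) ≤ Z
  inPositions≤ = allFin-≤ (2 + n) (≤-trans (m≤m+n (2 + n) _) (m≤n+m _ Q))

  cells≤ : length (allFin (suc T)) ≤ Z
  cells≤ = allFin-≤ (suc T) (≤-trans (m≤m+n (suc T) _) (≤-trans (m≤n+m _ (2 + n)) (m≤n+m _ Q)))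

  workSymbols≤ : length (allFin (suc Γ)) ≤ Z
  workSymbols≤ = allFin-≤ (suc Γ) (≤-trans (m≤n+m (suc Γ) (suc T)) (≤-trans (m≤n+m _ (2 + n)) (m≤n+m _ Q)))

  symbols≤ : length symbols ≤ Z
  symbols≤ = s≤s (s≤s (s≤s (s≤s z≤n)))

  symbolAt-size : ∀ {k} (ι : Fin k → Coord) p s → nnfSize (symbolAt ι p s) ≡ 0
  symbolAt-size ι zero s = refl
  symbolAt-size {zero}  ι (suc p)       s = refl
  symbolAt-size {suc k} ι (suc zero)    lend        = refl
  symbolAt-size {suc k} ι (suc zero)    rend        = refl
  symbolAt-size {suc k} ι (suc zero)    (bit false) = refl
  symbolAt-size {suc k} ι (suc zero)    (bit true)  = refl
  symbolAt-size {suc k} ι (suc (suc p)) s = symbolAt-size (ι ∘ Fin.suc) (suc p) s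

  readsInput-size : ∀ s → nnfSize (readsInput s) ≤ Z ^ 3
  readsInput-size s =
    ⋁-≤ (allFin (2 + n)) (λ p → and (var (inHeadAt p)) (symbolAt inputBit (toℕ p) s)) 1 inPositions≤
    (λ p → binary-≤ 0 z≤n (subst (_≤ 1) (sym (symbolAt-size inputBit (toℕ p) s)) z≤n))

  readsWork-size : ∀ a → nnfSize (readsWork a) ≤ Z ^ 3
  readsWork-size a =
    ⋁-≤ (allFin (suc T)) (λ j → and (var (workHeadAt j)) (var (cellHolds j a))) 1 cells≤ (λ j → binary-≤ 0 z≤n z≤n)

  dispatch-size : ∀ G → (∀ act → nnfSize (G act) ≤ Z ^ 3) → nnfSize (dispatch G) ≤ Z ^ 12
  dispatch-size G G≤ =
    ⋁-≤ (allFin Q) (λ q → and (var (stateIs q)) (onInputSymbol G q)) 10 states≤ λ q → binary-≤ 9 z≤n (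
      ⋁-≤ symbols (λ s → and (readsInput s) (onWorkSymbol G q s)) 7 symbols≤ λ s →
        binary-≤ 6 (raise 3 6 (readsInput-size s) (s≤s (s≤s (s≤s z≤n)))) (
          ⋁-≤ (allFin (suc Γ)) (λ a → and (readsWork a) (G (δ q s a))) 4 workSymbols≤ λ a →
            binary-≤ 3 (readsWork-size a) (G≤ (δ q s a))))

  next-size : ∀ u act → nnfSize (next u act) ≤ Z ^ 3
  next-size halted          (halt b)          = z≤n
  next-size accepted        (halt b)          = z≤n
  next-size (inputBit i)    act               = z≤n
  next-size (stateIs q)     (halt b)          = z≤n
  next-size (inHeadAt p)    (halt b)          = z≤n
  next-size (workHeadAt j)  (halt b)          = z≤n
  next-size (cellHolds j a) (halt b)          = z≤n
  next-size halted          (go q a mi mw o)  = z≤n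
  next-size accepted        (go q a mi mw o)  = z≤n
  next-size (stateIs q′)    (go q a mi mw o)  = z≤n
  next-size (inHeadAt p)    (go q a mi mw o)  = ⋁-≤ (allFin (2 + n))
    (λ p′ → and (var (inHeadAt p′)) (cst (toℕ p ≡ᵇ moveIn n mi (toℕ p′)))) 1 inPositions≤
    (λ _ → binary-≤ 0 z≤n z≤n)
  next-size (workHeadAt j)  (go q a mi mw o)  = ⋁-≤ (allFin (suc T))
    (λ j′ → and (var (workHeadAt j′)) (cst (toℕ j ≡ᵇ moveW mw (toℕ j′)))) 1 cells≤
    (λ _ → binary-≤ 0 z≤n z≤n)
  next-size (cellHolds j a′) (go q a mi mw o) =
    raise 2 3 (binary-≤ 1 (binary-≤ 0 z≤n z≤n) (binary-≤ 0 z≤n z≤n)) (s≤s (s≤s z≤n))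

  frozen-size : ∀ u → nnfSize (frozen u) ≡ 0
  frozen-size (stateIs q)     = refl
  frozen-size (inHeadAt p)    = refl
  frozen-size (workHeadAt j)  = refl
  frozen-size (cellHolds j a) = refl
  frozen-size (inputBit i)    = refl
  frozen-size halted          = refl
  frozen-size accepted        = refl

  stepFormula-size : ∀ u → nnfSize (stepFormula u) ≤ Z ^ 14
  stepFormula-size u = binary-≤ 13
    (binary-≤ 12 z≤n (subst (_≤ Z ^ 12) (sym (frozen-size u)) z≤n))
    (binary-≤ 12 z≤n (dispatch-size (next u) (next-size u)))

  initFormula-size : ∀ u → nnfSize (initFormula u) ≤ Z ^ 14
  initFormula-size (stateIs q)     = z≤n
  initFormula-size (inHeadAt p)    = z≤n
  initFormula-size (workHeadAt j)  = z≤n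
  initFormula-size (cellHolds j a) = z≤n
  initFormula-size (inputBit i)    = z≤n
  initFormula-size halted          = z≤n
  initFormula-size accepted        = z≤n

  coordCount : ℕ
  coordCount = Q + ((2 + n + suc T) + (suc T * suc Γ + (n + 2)))

  length-coords : length coords ≡ coordCount
  length-coords =
    trans (length-++ stateCoords) (cong₂ _+_ (allFin-count stateIs)
    (trans (length-++ headCoords) (cong₂ _+_
      (trans (length-++ (map inHeadAt (allFin (2 + n)))) (cong₂ _+_ (allFin-count inHeadAt) (allFin-count workHeadAt)))
    (trans (length-++ cellCoords) (cong₂ _+_
      (trans (length-cartesianProductWith cellHolds (allFin (suc T)) (allFin (suc Γ)))
             (cong₂ _*_ (length-tabulate {n = suc T} (λ i → i)) (length-tabulate {n = suc Γ} (λ i → i))))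
    (trans (length-++ inputCoords) (cong (_+ 2) (allFin-count inputBit))))))))
    where
    allFin-count : ∀ {k} (c : Fin k → Coord) → length (map c (allFin k)) ≡ k
    allFin-count {k} c = trans (length-map c (allFin k)) (length-tabulate (λ i → i))

  module Layered = IteratedCircuit coords coords-complete n initFormula stepFormula T
  open Layers coords coords-complete {n * 2} using (layerCost; layerCost-≤)

  circuit : MonCircuit (n * 2)
  circuit = Layered.circuit accepted

  circuit-size : size circuit ≤ suc T * (coordCount * Z ^ 14 + coordCount * Z ^ 14)
  circuit-size = begin
    size circuit
      ≡⟨ Layered.circuit-size accepted ⟩
    layerCost initFormula + T * layerCost stepFormula
      ≤⟨ +-mono-≤ (layerCost-≤ initFormula initFormula-size) (*-monoʳ-≤ T (layerCost-≤ stepFormula stepFormula-size)) ⟩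
    suc T * (length coords * Z ^ 14 + length coords * Z ^ 14)
      ≡⟨ cong (λ l → suc T * (l * Z ^ 14 + l * Z ^ 14)) length-coords ⟩
    suc T * (coordCount * Z ^ 14 + coordCount * Z ^ 14) ∎
    where open ≤-Reasoning

  circuit-correct : ∀ v b cf → HaltsWithin M (toList v) T b cf → eval circuit (lookup (flat v)) ≡ b
  circuit-correct v b cf halts = trans (Layered.circuit-sound accepted v) (Run.simulation-correct v b cf halts)

PolyBounded : (ℕ → ℕ) → Set
PolyBounded f = Σ ℕ λ c → Σ ℕ λ k → ∀ n → f n ≤ c * suc n ^ k

poly-≤ : ∀ {f g : ℕ → ℕ} → (∀ n → f n ≤ g n) → PolyBounded g → PolyBounded f
poly-≤ f≤g (c , k , g≤) = c , k , λ n → ≤-trans (f≤g n) (g≤ n)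

poly-const : ∀ a → PolyBounded (λ _ → a)
poly-const a = a , 0 , λ n → ≤-reflexive (sym (*-identityʳ a))

poly-id : PolyBounded (λ n → n)
poly-id = 1 , 1 , λ n → ≤-trans (n≤1+n n) (≤-reflexive (sym (trans (*-identityˡ _) (*-identityʳ _))))

poly-+ : ∀ {f g : ℕ → ℕ} → PolyBounded f → PolyBounded g → PolyBounded (λ n → f n + g n)
poly-+ {f} {g} (c₁ , k₁ , f≤) (c₂ , k₂ , g≤) = c₁ + c₂ , k₁ + k₂ , λ n → begin
  f n + g n
    ≤⟨ +-mono-≤ (f≤ n) (g≤ n) ⟩
  c₁ * suc n ^ k₁ + c₂ * suc n ^ k₂
    ≤⟨ +-mono-≤ (*-monoʳ-≤ c₁ (^-monoʳ-≤ (suc n) (m≤m+n k₁ k₂))) (*-monoʳ-≤ c₂ (^-monoʳ-≤ (suc n) (m≤n+m k₂ k₁))) ⟩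
  c₁ * suc n ^ (k₁ + k₂) + c₂ * suc n ^ (k₁ + k₂)
    ≡⟨ *-distribʳ-+ (suc n ^ (k₁ + k₂)) c₁ c₂ ⟨
  (c₁ + c₂) * suc n ^ (k₁ + k₂) ∎
  where open ≤-Reasoning

poly-* : ∀ {f g : ℕ → ℕ} → PolyBounded f → PolyBounded g → PolyBounded (λ n → f n * g n)
poly-* {f} {g} (c₁ , k₁ , f≤) (c₂ , k₂ , g≤) = c₁ * c₂ , k₁ + k₂ , λ n → begin
  f n * g n
    ≤⟨ *-mono-≤ (f≤ n) (g≤ n) ⟩
  (c₁ * suc n ^ k₁) * (c₂ * suc n ^ k₂)
    ≡⟨ [m*n]*[o*p]≡[m*o]*[n*p] c₁ _ c₂ _ ⟩
  (c₁ * c₂) * (suc n ^ k₁ * suc n ^ k₂)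
    ≡⟨ cong (c₁ * c₂ *_) (^-distribˡ-+-* (suc n) k₁ k₂) ⟨
  (c₁ * c₂) * suc n ^ (k₁ + k₂) ∎
  where open ≤-Reasoning

poly-^ : ∀ {f : ℕ → ℕ} → PolyBounded f → ∀ e → PolyBounded (λ n → f n ^ e)
poly-^ p zero    = poly-const 1
poly-^ p (suc e) = poly-* p (poly-^ p e)

-- the form used in the statement: c * n ^ k + c
poly-normal-form : ∀ {f : ℕ → ℕ} → PolyBounded f → Σ ℕ λ c → Σ ℕ λ k → ∀ n → f n ≤ c * n ^ k + c
poly-normal-form {f} (c , k , f≤) = c * 2 ^ k , k , λ n → begin
  f n                               ≤⟨ f≤ n ⟩
  c * suc n ^ k                     ≤⟨ *-monoʳ-≤ c (suc-^ n) ⟩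
  c * (2 ^ k * n ^ k + 2 ^ k)       ≡⟨ *-distribˡ-+ c (2 ^ k * n ^ k) (2 ^ k) ⟩
  c * (2 ^ k * n ^ k) + c * 2 ^ k   ≡⟨ cong (_+ c * 2 ^ k) (*-assoc c (2 ^ k) (n ^ k)) ⟨
  c * 2 ^ k * n ^ k + c * 2 ^ k     ∎
  where
  open ≤-Reasoning
  ^-distribʳ-* : ∀ a b e → (a * b) ^ e ≡ a ^ e * b ^ e
  ^-distribʳ-* a b zero    = refl
  ^-distribʳ-* a b (suc e) = trans (cong (a * b *_) (^-distribʳ-* a b e)) ([m*n]*[o*p]≡[m*o]*[n*p] a b _ _)
  -- for n ≥ 1 this follows from 1 + n ≤ 2 * n
  suc-^ : ∀ n → suc n ^ k ≤ 2 ^ k * n ^ k + 2 ^ k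
  suc-^ zero    = ≤-trans (≤-reflexive (^-zeroˡ k)) (≤-trans (m^n>0 2 k) (m≤n+m _ _))
  suc-^ (suc n) = ≤-trans (^-monoˡ-≤ k 2+n≤2*[1+n])
                    (≤-trans (≤-reflexive (^-distribʳ-* 2 (suc n) k)) (m≤m+n _ _))
    where
    2+n≤2*[1+n] : suc (suc n) ≤ 2 * suc n
    2+n≤2*[1+n] = ≤-trans (+-monoˡ-≤ (suc n) (s≤s z≤n)) (≤-reflexive (cong (suc n +_) (sym (+-identityʳ (suc n)))))

-- Every language decided in polynomial time has polynomial-size monotone
-- circuits for its flattening: simulate the decider for its time bound.
flat-circuits : (A : Language) → InP A →
    Σ ℕ λ c → Σ ℕ λ k → Σ ((n : ℕ) → MonCircuit (n * 2)) λ C →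
      (n : ℕ) → size (C n) ≤ c * n ^ k + c ×
        ((w : Vec Bool n) → (eval (C n) (lookup (flat w)) ≡ true ⇔ A (toList w)))
flat-circuits A (M , c , k , decides) =
  proj₁ bound , proj₁ (proj₂ bound) , C , λ n → proj₂ (proj₂ bound) n , correct n
  where
  open Machine M

  time : ℕ → ℕ
  time n = c * n ^ k + c

  C : (n : ℕ) → MonCircuit (n * 2)
  C n = Simulation.circuit M n (time n)

  time+1-poly : PolyBounded (λ n → suc (time n))
  time+1-poly = poly-+ (poly-const 1) (poly-+ (poly-* (poly-const c) (poly-^ poly-id k)) (poly-const c))

  count-poly : PolyBounded (λ n → Simulation.coordCount M n (time n))
  count-poly = poly-+ (poly-const Q) (poly-+ (poly-+ (poly-+ (poly-const 2) poly-id) time+1-poly)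
                 (poly-+ (poly-* time+1-poly (poly-const (suc Γ))) (poly-+ poly-id (poly-const 2))))

  Z-poly : PolyBounded (λ n → FormulaBounds.Z (Simulation.width M n (time n)))
  Z-poly = poly-+ (poly-const 4) (poly-+ (poly-const Q)
             (poly-+ (poly-+ (poly-const 2) poly-id) (poly-+ time+1-poly (poly-const (suc Γ)))))

  layer-poly : PolyBounded λ n →
    Simulation.coordCount M n (time n) * FormulaBounds.Z (Simulation.width M n (time n)) ^ 14
  layer-poly = poly-* count-poly (poly-^ Z-poly 14)

  bound : Σ ℕ λ c′ → Σ ℕ λ k′ → ∀ n → size (C n) ≤ c′ * n ^ k′ + c′
  bound = poly-normal-form (poly-≤ (λ n → Simulation.circuit-size M n (time n))
                                   (poly-* time+1-poly (poly-+ layer-poly layer-poly)))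

  correct : (n : ℕ) (w : Vec Bool n) → eval (C n) (lookup (flat w)) ≡ true ⇔ A (toList w)
  correct n w with decides (toList w)
  ... | b , cf , halts , b⇔A =
    mk⇔ (λ e → Equivalence.to b⇔A (trans (sym C≡b) e)) (λ a → trans C≡b (Equivalence.from b⇔A a))
    where
    C≡b : eval (C n) (lookup (flat w)) ≡ b
    C≡b = Simulation.circuit-correct M n (time n) w b cf
            (subst (λ len → HaltsWithin M (toList w) (c * len ^ k + c) b cf) (length-toList w) halts)

theorem6 : (A : Language) → PComplete A →
    Σ ℕ λ c → Σ ℕ λ k → Σ ((n : ℕ) → MonCircuit (n * 2)) λ C →
      (n : ℕ) → size (C n) ≤ c * n ^ k + c ×
        ((w : Vec Bool n) → (eval (C n) (lookup (flat w)) ≡ true ⇔ A (toList w)))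
theorem6 A (A∈P , _) = flat-circuits A A∈P
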